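{- Let $k\ge2$ and let $H$ be the $k$-uniform simplex on $[k+1]$. For a derangement $\sigma$ of $[k+1]$ let $D_\sigma=\bigcup_{i=1}^{k+1}S_{[k+1]\setminus\{\sigma(i)\}}(i)$ and $\tau_\sigma=\tau_{D_\sigma}$. Then \[ C_H=\sum_{\sigma\in\mathfrak D_{k+1}}\frac{\tau_\sigma}{\prod_{v\in V(D_\sigma)}\deg^-(v)}. \]
   Context: $\mathfrak D_{k+1}$ is the set of derangements of $[k+1]$. For a $k$-set $e$ and $u\in e$, $S_e(u)$ is the digraph with arcs $uv$, $v\in e\setminus\{u\}$; unions add arc multiplicities. A rooting of $H$ is a sequence $R=((e_1,v_1),\dots,(e_m,v_m))$ with $\{e_1,\dots,e_m\}=E(H)$ as multisets, $v_i\in e_i$, $v_1\le\dots\le v_m$; $D_R=\bigcup_iS_{e_i}(v_i)$; $R$ is an Euler rooting if $D_R$ is Eulerian (weakly connected, in-degree equal to out-degree everywhere). $R(H)$ is the multiset of $D_R$ over all Euler rootings. For Eulerian $D$, $\tau_D$ is the number of spanning arborescences of $D$ with a fixed root. The associated coefficient is $C_H=\sum_{D\in R(H)}\tau_D/\prod_{v\in V(D)}\deg^-_D(v)$. -}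

module Defs where

open import Data.Bool using (Bool; true; false; _∧_; _∨_; not; if_then_else_)
open import Data.Nat using (ℕ; zero; suc; _≡ᵇ_)
import Data.Nat as ℕ
open import Data.Fin using (Fin; zero; suc; _≤?_)
open import Data.Fin.Properties using () renaming (_≟_ to _≟F_)
open import Data.List using (List; []; _∷_; map; concatMap; foldr; allFin)
open import Data.Bool.ListAction using (all; any)
open import Data.Nat.ListAction using (sum; product)
open import Data.Product using (_×_; _,_; proj₁; proj₂)
open import Data.Integer using (+_)
open import Data.Rational using (ℚ; 0ℚ; _/_) renaming (_+_ to _+ℚ_)
open import Relation.Nullary.Decidable using (⌊_⌋)

eqF : {n : ℕ} → Fin n → Fin n → Bool
eqF a b = ⌊ a ≟F b ⌋

leF : {n : ℕ} → Fin n → Fin n → Bool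
leF a b = ⌊ a ≤? b ⌋

allB : {n : ℕ} → (Fin n → Bool) → Bool
allB p = all p (allFin _)

anyB : {n : ℕ} → (Fin n → Bool) → Bool
anyB p = any p (allFin _)

count : {n : ℕ} → (Fin n → Bool) → ℕ
count p = sum (map (λ i → if p i then 1 else 0) (allFin _))

sumF : {n : ℕ} → (Fin n → ℕ) → ℕ
sumF f = sum (map f (allFin _))

prodF : {n : ℕ} → (Fin n → ℕ) → ℕ
prodF f = product (map f (allFin _))

cons : {m n : ℕ} → Fin n → (Fin m → Fin n) → (Fin (suc m) → Fin n)
cons x f zero = x
cons x f (suc i) = f i

allFuns : (m n : ℕ) → List (Fin m → Fin n)
allFuns zero n = (λ ()) ∷ []
allFuns (suc m) n = concatMap (λ x → map (cons x) (allFuns m n)) (allFin n)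

sumℚ : List ℚ → ℚ
sumℚ = foldr _+ℚ_ 0ℚ

-- a / b in ℚ (only used with b ≠ 0; returns 0 if b = 0)
ratio : ℕ → ℕ → ℚ
ratio a zero = 0ℚ
ratio a (suc b) = (+ a) / suc b

-- Directed multigraphs on vertex set Fin n: D u w = multiplicity of arc uw

Digraph : ℕ → Set
Digraph n = Fin n → Fin n → ℕ

outdeg : {n : ℕ} → Digraph n → Fin n → ℕ
outdeg D u = sumF (λ w → D u w)

indeg : {n : ℕ} → Digraph n → Fin n → ℕ
indeg D w = sumF (λ u → D u w)

balanced : {n : ℕ} → Digraph n → Bool
balanced D = allB (λ v → indeg D v ≡ᵇ outdeg D v)

adj : {n : ℕ} → Digraph n → Fin n → Fin n → Bool
adj D u w = not ((D u w ℕ.+ D w u) ≡ᵇ 0)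

reach : {n : ℕ} → Digraph n → ℕ → Fin n → Fin n → Bool
reach D zero u w = eqF u w
reach D (suc t) u w = reach D t u w ∨ anyB (λ x → reach D t u x ∧ adj D x w)

-- weakly connected (walks of length ≤ n suffice on n vertices)
weaklyConnected : {n : ℕ} → Digraph n → Bool
weaklyConnected {n} D = allB (λ u → allB (λ w → reach D n u w))

Eulerian : {n : ℕ} → Digraph n → Bool
Eulerian D = weaklyConnected D ∧ balanced D

iter : {n : ℕ} → ℕ → (Fin n → Fin n) → Fin n → Fin n
iter zero p v = v
iter (suc t) p v = p (iter t p v)

-- Spanning arborescences of D rooted at r (arcs directed away from r):
-- given by a parent map p with p r = r such that every vertex reaches r
-- by following parents; the arc p v → v is chosen among the D (p v) v
-- parallel arcs, so each parent map contributes Π_{v ≠ r} D (p v) v.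
isParentTree : {n : ℕ} → Fin n → (Fin n → Fin n) → Bool
isParentTree {n} r p = eqF (p r) r ∧ allB (λ v → eqF (iter n p v) r)

arbWeight : {n : ℕ} → Digraph n → Fin n → (Fin n → Fin n) → ℕ
arbWeight D r p = prodF (λ v → if eqF v r then 1 else D (p v) v)

arborescences : {n : ℕ} → Digraph n → Fin n → ℕ
arborescences {n} D r =
  sum (map (λ p → if isParentTree r p then arbWeight D r p else 0) (allFuns n n))

τ : {m : ℕ} → Digraph (suc m) → ℕ
τ D = arborescences D zero

coef : {m : ℕ} → Digraph (suc m) → ℚ
coef D = ratio (τ D) (prodF (indeg D))

-- Hypergraphs on Fin n with m edges, edges indexed by Fin m,
-- edge j given by its membership predicate.

Hypergraph : ℕ → ℕ → Set
Hypergraph n m = Fin m → Fin n → Bool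

S : {n : ℕ} → (Fin n → Bool) → Fin n → Digraph n
S e u x w = if eqF x u ∧ e w ∧ not (eqF w u) then 1 else 0

⋃ : {n m : ℕ} → (Fin m → Digraph n) → Digraph n
⋃ Ds x w = sumF (λ i → Ds i x w)

-- A rooting R = ((e_1,v_1),…,(e_m,v_m)) is given by
--   e : Fin m → Fin m  (e i is the index in H of the i-th edge)
--   v : Fin m → Fin n  (the i-th root)
-- with {e_1,…,e_m} = E(H) as multisets (each edge of H occurs exactly once),
-- v_i ∈ e_i, and v_1 ≤ … ≤ v_m.
isRooting : {n m : ℕ} → Hypergraph n m → (Fin m → Fin m) → (Fin m → Fin n) → Bool
isRooting H e v =
  allB (λ j → count (λ i → eqF (e i) j) ≡ᵇ 1)
  ∧ allB (λ i → H (e i) (v i))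
  ∧ allB (λ i → allB (λ j → not (leF i j) ∨ leF (v i) (v j)))

D_R : {n m : ℕ} → Hypergraph n m → (Fin m → Fin m) → (Fin m → Fin n) → Digraph n
D_R H e v = ⋃ (λ i → S (H (e i)) (v i))

C : {k m : ℕ} → Hypergraph (suc k) m → ℚ
C {k} {m} H =
  sumℚ (concatMap (λ e → concatMap (λ v →
         if isRooting H e v ∧ Eulerian (D_R H e v)
         then coef (D_R H e v) ∷ [] else [])
       (allFuns m (suc k))) (allFuns m m))

simplex : (k : ℕ) → Hypergraph (suc k) (suc k)
simplex k j w = not (eqF w j)

isDerangement : {n : ℕ} → (Fin n → Fin n) → Bool
isDerangement σ =
  allB (λ j → count (λ i → eqF (σ i) j) ≡ᵇ 1) ∧ allB (λ i → not (eqF (σ i) i))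

derangements : (n : ℕ) → List (Fin n → Fin n)
derangements n =
  concatMap (λ σ → if isDerangement σ then σ ∷ [] else []) (allFuns n n)

Dσ : {n : ℕ} → (Fin n → Fin n) → Digraph n
Dσ σ = ⋃ (λ i → S (λ w → not (eqF w (σ i))) i)

module Submission where

-- Write the i-th edge of a rooting as [k+1] \ {e_i}, with root v_i ≠ e_i. In D_R a vertex w that
-- is the root of r w edges has out-degree (r w)(k - 1) and in-degree k - r w, since the i-th edge
-- sends an arc into w unless w = e_i (true for exactly one i) or w = v_i. So D_R is balanced iff
-- every vertex is the root of exactly one edge; as the roots are sorted this forces v_i = i, so
-- i ↦ e_i is a derangement σ and D_R = D_σ. Conversely, for such a rooting every vertex u has an
-- arc to every w ∉ {u, σ u}, which for k ≥ 2 makes the underlying graph connected of diameter ≤ 2.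

open import Defs
open import Data.Bool using (Bool; true; false; _∧_; _∨_; not; if_then_else_; T)
open import Data.Bool.Properties using (T-∧; T-∨; T-≡; T?; ∧-identityʳ)
open import Data.Empty using (⊥-elim)
open import Data.Fin using (Fin; zero; suc; punchIn; punchOut)
open import Data.Vec.Functional using (removeAt)
import Data.Fin.Base as Fin
open import Data.Fin.Induction using (<-wellFounded)
open import Data.Fin.Properties using (any?; punchIn-punchOut; punchInᵢ≢i) renaming (_≟_ to _≟F_)
import Data.Fin.Properties as Fin
open import Data.List using (List; []; _∷_; _++_; concat; concatMap; map; tabulate; allFin)
open import Data.List.Effectful using (module MonadProperties)
open import Data.List.Properties
  using (map-tabulate; map-cong; concatMap-cong; concatMap-map; map-concatMap; ++-identityʳ)
open import Data.List.Relation.Unary.All.Properties using (all⁺; all⁻)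
import Data.List.Relation.Unary.All.Properties as Allₚ
open import Data.List.Relation.Unary.Any.Properties using (any⁺)
import Data.List.Relation.Unary.Any.Properties as Anyₚ
open import Data.Nat
  using (ℕ; zero; suc; _+_; _*_; _≤_; s≤s; z≤n; NonZero; _≡ᵇ_; _≤′_; ≤′-reflexive; ≤′-step)
open import Data.Nat.ListAction using (product) renaming (sum to sumList)
import Data.Nat.Properties as ℕ
open import Algebra.Properties.Semiring.Sum ℕ.+-*-semiring
open import Data.Product using (∃; _×_; _,_; proj₁; proj₂)
import Data.Product as Product
open import Data.Sum using (inj₁; inj₂)
open import Function using (_∘_; id; case_of_; _⇔_; mk⇔; Equivalence)
open import Function.Definitions using (Injective)
open import Induction.WellFounded as WF using ()
open import Level using (0ℓ)
open import Relation.Binary.Core using (_Preserves_⟶_)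
open import Relation.Binary.PropositionalEquality
open import Relation.Nullary using (¬_; yes; no; Dec)
open import Relation.Nullary.Decidable
  using (toWitness; fromWitness; toWitnessFalse; fromWitnessFalse; isYes≗does; dec-true; dec-false)

open Equivalence using (to; from)

ind : Bool → ℕ
ind b = if b then 1 else 0

ind-T : ∀ {b} → T b → ind b ≡ 1
ind-T {true} _ = refl

ind-¬T : ∀ {b} → ¬ T b → ind b ≡ 0
ind-¬T {true} ¬b = ⊥-elim (¬b _)
ind-¬T {false} _ = refl

ind+ind-not : ∀ b → ind b + ind (not b) ≡ 1
ind+ind-not true = refl
ind+ind-not false = refl

ind-∧ : ∀ a b → ind (a ∧ b) ≡ ind a * ind b
ind-∧ true b = sym (ℕ.*-identityˡ (ind b))
ind-∧ false b = refl

eqF-refl : ∀ {n} (a : Fin n) → eqF a a ≡ true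
eqF-refl a = trans (isYes≗does (a ≟F a)) (dec-true (a ≟F a) refl)

eqF-≢ : ∀ {n} {a b : Fin n} → a ≢ b → eqF a b ≡ false
eqF-≢ {a = a} {b} a≢b = trans (isYes≗does (a ≟F b)) (dec-false (a ≟F b) a≢b)

eqF-sym : ∀ {n} (a b : Fin n) → eqF a b ≡ eqF b a
eqF-sym a b = by-cases (a ≟F b)
  where
  by-cases : Dec (a ≡ b) → eqF a b ≡ eqF b a
  by-cases (yes a≡b) = cong₂ eqF a≡b (sym a≡b)
  by-cases (no a≢b) = trans (eqF-≢ a≢b) (sym (eqF-≢ (a≢b ∘ sym)))

T-eqF : ∀ {n} {a b : Fin n} → T (eqF a b) ⇔ a ≡ b
T-eqF = mk⇔ toWitness fromWitness

T-not-eqF : ∀ {n} {a b : Fin n} → T (not (eqF a b)) ⇔ a ≢ b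
T-not-eqF = mk⇔ toWitnessFalse fromWitnessFalse

T-leF : ∀ {n} {a b : Fin n} → T (leF a b) ⇔ a Fin.≤ b
T-leF = mk⇔ toWitness fromWitness

T-≡ᵇ : ∀ {m n} → T (m ≡ᵇ n) ⇔ m ≡ n
T-≡ᵇ = mk⇔ (ℕ.≡ᵇ⇒≡ _ _) (ℕ.≡⇒≡ᵇ _ _)

T-not-∨ : ∀ a {b} → T (not a ∨ b) ⇔ (T a → T b)
T-not-∨ true = mk⇔ (λ b _ → b) (λ a⇒b → a⇒b _)
T-not-∨ false = mk⇔ (λ _ ()) (λ _ → _)

T-allB : ∀ {n} (p : Fin n → Bool) → T (allB p) ⇔ (∀ i → T (p i))
T-allB p = mk⇔ (Allₚ.tabulate⁻ ∘ all⁺ p _) (all⁻ p ∘ Allₚ.tabulate⁺)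

anyB-intro : ∀ {n} {p : Fin n → Bool} a → T (p a) → T (anyB p)
anyB-intro {p = p} a pa = any⁺ p (Anyₚ.tabulate⁺ a pa)

T-Eulerian : ∀ {n} {D : Digraph n} →
             T (Eulerian D) ⇔ (T (weaklyConnected D) × (∀ w → indeg D w ≡ outdeg D w))
T-Eulerian {D = D} = mk⇔
  (λ h → let (conn , bal) = to (T-∧ {weaklyConnected D}) h in
    conn , λ w → to T-≡ᵇ (to (T-allB balanced-at) bal w))
  (λ (conn , bal) → from T-∧ (conn , from (T-allB balanced-at) (λ w → from T-≡ᵇ (bal w))))
  where
  balanced-at = λ w → indeg D w ≡ᵇ outdeg D w

EachOnce : ∀ {n} → (Fin n → Fin n) → Set
EachOnce σ = ∀ j → count (λ i → eqF (σ i) j) ≡ 1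

T-isDerangement : ∀ {n} {σ : Fin n → Fin n} →
                  T (isDerangement σ) ⇔ (EachOnce σ × (∀ i → σ i ≢ i))
T-isDerangement {σ = σ} = mk⇔
  (λ h → let (once , moved) = to (T-∧ {allB hit-once}) h in
    (λ j → to T-≡ᵇ (to (T-allB hit-once) once j)) ,
    (λ i → to T-not-eqF (to (T-allB moves) moved i)))
  (λ (once , moved) → from T-∧
    ( from (T-allB hit-once) (λ j → from T-≡ᵇ (once j))
    , from (T-allB moves) (λ i → from T-not-eqF (moved i))))
  where
  hit-once = λ j → count (λ i → eqF (σ i) j) ≡ᵇ 1
  moves = λ i → not (eqF (σ i) i)

-- Sums and counts over Fin n

sumF≡∑ : ∀ {n} (f : Fin n → ℕ) → sumF f ≡ ∑[ i < n ] f i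
sumF≡∑ f = trans (cong sumList (map-tabulate id f)) (sum-tabulate f)
  where
  sum-tabulate : ∀ {n} (f : Fin n → ℕ) → sumList (tabulate f) ≡ sum f
  sum-tabulate {zero} f = refl
  sum-tabulate {suc n} f = cong (f zero +_) (sum-tabulate (f ∘ suc))

count≡∑ : ∀ {n} (p : Fin n → Bool) → count p ≡ ∑[ i < n ] ind (p i)
count≡∑ p = sumF≡∑ (ind ∘ p)

count-cong : ∀ {n} {p q : Fin n → Bool} → (∀ i → p i ≡ q i) → count p ≡ count q
count-cong p≗q = cong sumList (map-cong (cong ind ∘ p≗q) (allFin _))

∑-1 : ∀ n → ∑[ i < n ] 1 ≡ n
∑-1 zero = refl
∑-1 (suc n) = cong suc (∑-1 n)

∑-point : ∀ {n} {f : Fin n → ℕ} a → (∀ i → i ≢ a → f i ≡ 0) → sum f ≡ f a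
∑-point {suc n} {f} a f≡0 = begin
  sum f                      ≡⟨ sum-remove f ⟩
  f a + sum (removeAt f a)   ≡⟨ cong (f a +_) rest≡0 ⟩
  f a + 0                    ≡⟨ ℕ.+-identityʳ (f a) ⟩
  f a                        ∎
  where
  open ≡-Reasoning
  rest≡0 = trans (sum-cong-≗ (λ i → f≡0 _ (punchInᵢ≢i a i))) (sum-replicate-zero n)

∑-≥-pair : ∀ {n} (f : Fin n → ℕ) {a b} → a ≢ b → f a + f b ≤ sum f
∑-≥-pair {suc n} f {a} {b} a≢b = begin
  f a + f b ≡⟨ cong (λ c → f a + f c) (sym (punchIn-punchOut a≢b)) ⟩
  f a + removeAt f a (punchOut a≢b) ≤⟨ ℕ.+-mono-≤ ℕ.≤-refl (elem≤sum (removeAt f a) _) ⟩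
  f a + sum (removeAt f a) ≡⟨ sym (sum-remove f) ⟩
  sum f ∎
  where
  open ℕ.≤-Reasoning
  elem≤sum : ∀ {n} (g : Fin n → ℕ) i → g i ≤ sum g
  elem≤sum g zero = ℕ.m≤m+n _ _
  elem≤sum g (suc i) = ℕ.≤-trans (elem≤sum (g ∘ suc) i) (ℕ.m≤n+m _ (g zero))

count+count-not : ∀ {n} (p : Fin n → Bool) → count p + count (not ∘ p) ≡ n
count+count-not {n} p = begin
  count p + count (not ∘ p)                 ≡⟨ cong₂ _+_ (count≡∑ p) (count≡∑ (not ∘ p)) ⟩
  sum (ind ∘ p) + sum (ind ∘ not ∘ p)       ≡⟨ ∑-distrib-+ (ind ∘ p) (ind ∘ not ∘ p) ⟨
  ∑[ i < n ] (ind (p i) + ind (not (p i)))  ≡⟨ sum-cong-≗ (ind+ind-not ∘ p) ⟩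
  ∑[ i < n ] 1                              ≡⟨ ∑-1 n ⟩
  n                                         ∎
  where open ≡-Reasoning

count-none : ∀ {n} (p : Fin n → Bool) → (∀ i → ¬ T (p i)) → count p ≡ 0
count-none {n} p ∄p =
  trans (count≡∑ p) (trans (sum-cong-≗ (ind-¬T ∘ ∄p)) (sum-replicate-zero n))

count≡1⇒unique : ∀ {n} (p : Fin n → Bool) {a b} →
                 count p ≡ 1 → T (p a) → T (p b) → a ≡ b
count≡1⇒unique p {a} {b} count≡1 pa pb with a ≟F b
... | yes a≡b = a≡b
... | no a≢b = ⊥-elim (ℕ.1+n≰n (begin
  2                       ≡⟨ cong₂ _+_ (ind-T pa) (ind-T pb) ⟨
  ind (p a) + ind (p b)   ≤⟨ ∑-≥-pair (ind ∘ p) a≢b ⟩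
  sum (ind ∘ p)           ≡⟨ count≡∑ p ⟨
  count p                 ≡⟨ count≡1 ⟩
  1                       ∎))
  where open ℕ.≤-Reasoning

count≡1⇒∃ : ∀ {n} (p : Fin n → Bool) → count p ≡ 1 → ∃ (T ∘ p)
count≡1⇒∃ {n} p count≡1 with any? (λ i → T? (p i))
... | yes ∃p = ∃p
... | no ∄p = case trans (sym count≡1) (count-none p (λ i pi → ∄p (i , pi))) of λ ()

count-point : ∀ {n} (a : Fin n) → count (λ w → eqF w a) ≡ 1
count-point a = begin
  count (λ w → eqF w a)      ≡⟨ count≡∑ (λ w → eqF w a) ⟩
  sum (λ w → ind (eqF w a))  ≡⟨ ∑-point a (λ w w≢a → cong ind (eqF-≢ w≢a)) ⟩
  ind (eqF a a)              ≡⟨ cong ind (eqF-refl a) ⟩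
  1                          ∎
  where open ≡-Reasoning

count-avoiding₁ : ∀ {k} (a : Fin (suc k)) → count (λ w → not (eqF w a)) ≡ k
count-avoiding₁ {k} a = ℕ.suc-injective (begin
  suc (count avoid-a)                       ≡⟨ cong (_+ count avoid-a) (count-point a) ⟨
  count (λ w → eqF w a) + count avoid-a     ≡⟨ count+count-not (λ w → eqF w a) ⟩
  suc k                                     ∎)
  where
  open ≡-Reasoning
  avoid-a = λ w → not (eqF w a)

ind-≢-split : ∀ {n} {a b : Fin n} → a ≢ b → ∀ w →
              ind (not (eqF w a)) ≡ ind (not (eqF w a) ∧ not (eqF w b)) + ind (eqF w b)
ind-≢-split {a = a} {b} a≢b w = by-cases (w ≟F b)
  where
  by-cases : Dec (w ≡ b) → ind (not (eqF w a)) ≡ ind (not (eqF w a) ∧ not (eqF w b)) + ind (eqF w b)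
  by-cases (yes refl) rewrite eqF-≢ (a≢b ∘ sym) | eqF-refl w = refl
  by-cases (no w≢b) rewrite eqF-≢ w≢b | ∧-identityʳ (not (eqF w a)) = sym (ℕ.+-identityʳ _)

count-avoiding₂ : ∀ {k} {a b : Fin (suc k)} → a ≢ b →
                  suc (count (λ w → not (eqF w a) ∧ not (eqF w b))) ≡ k
count-avoiding₂ {k} {a} {b} a≢b = begin
  suc (count avoid-ab)
    ≡⟨ ℕ.+-comm 1 _ ⟩
  count avoid-ab + 1
    ≡⟨ cong (count avoid-ab +_) (count-point b) ⟨
  count avoid-ab + count (λ w → eqF w b)
    ≡⟨ cong₂ _+_ (count≡∑ avoid-ab) (count≡∑ (λ w → eqF w b)) ⟩
  sum (ind ∘ avoid-ab) + sum (λ w → ind (eqF w b))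
    ≡⟨ ∑-distrib-+ (ind ∘ avoid-ab) (λ w → ind (eqF w b)) ⟨
  ∑[ w < suc k ] (ind (avoid-ab w) + ind (eqF w b))
    ≡⟨ sum-cong-≗ (ind-≢-split a≢b) ⟨
  sum (λ w → ind (not (eqF w a)))
    ≡⟨ count≡∑ (λ w → not (eqF w a)) ⟨
  count (λ w → not (eqF w a))
    ≡⟨ count-avoiding₁ a ⟩
  k ∎
  where
  open ≡-Reasoning
  avoid-ab = λ w → not (eqF w a) ∧ not (eqF w b)

-- Sorted self-maps of Fin n

sorted-bijection⇒id : ∀ {n} (v : Fin n → Fin n) →
                      Injective _≡_ _≡_ v → (∀ w → ∃ λ i → v i ≡ w) →
                      v Preserves Fin._≤_ ⟶ Fin._≤_ → ∀ i → v i ≡ i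
sorted-bijection⇒id v v-inj v-surj v-mono = WF.All.wfRec <-wellFounded 0ℓ (λ i → v i ≡ i) step
  where
  step : ∀ a → (∀ {i} → i Fin.< a → v i ≡ i) → v a ≡ a
  step a v≡id-below = Fin.≤-antisym va≤a a≤va
    where
    c = proj₁ (v-surj a)
    vc≡a = proj₂ (v-surj a)
    a≤c : a Fin.≤ c
    a≤c = ℕ.≮⇒≥ (λ c<a → Fin.<-irrefl (trans (sym (v≡id-below c<a)) vc≡a) c<a)
    va≤a : v a Fin.≤ a
    va≤a = subst (v a Fin.≤_) vc≡a (v-mono a≤c)
    a≤va : a Fin.≤ v a
    a≤va = ℕ.≮⇒≥ (λ va<a → Fin.<-irrefl (v-inj (v≡id-below va<a)) va<a)

rootCount : ∀ {m n} → (Fin m → Fin n) → Fin n → ℕ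
rootCount v u = count (λ i → eqF u (v i))

sorted-with-unit-rootCounts⇒id : ∀ {n} (v : Fin n → Fin n) → (∀ w → rootCount v w ≡ 1) →
                                 v Preserves Fin._≤_ ⟶ Fin._≤_ → ∀ i → v i ≡ i
sorted-with-unit-rootCounts⇒id v once = sorted-bijection⇒id v injective surjective
  where
  injective : Injective _≡_ _≡_ v
  injective {a} {b} va≡vb =
    count≡1⇒unique (λ i → eqF (v a) (v i)) (once (v a)) (from T-eqF refl) (from T-eqF va≡vb)
  surjective : ∀ w → ∃ λ i → v i ≡ w
  surjective w = Product.map₂ (sym ∘ to T-eqF) (count≡1⇒∃ (λ i → eqF w (v i)) (once w))

-- Degrees and connectivity of digraphs

indeg-⋃ : ∀ {n m} (Ds : Fin m → Digraph n) w → indeg (⋃ Ds) w ≡ ∑[ i < m ] indeg (Ds i) w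
indeg-⋃ {n} {m} Ds w = begin
  indeg (⋃ Ds) w                      ≡⟨ sumF≡∑ (λ u → ⋃ Ds u w) ⟩
  ∑[ u < n ] sumF (λ i → Ds i u w)     ≡⟨ sum-cong-≗ (λ u → sumF≡∑ (λ i → Ds i u w)) ⟩
  ∑[ u < n ] ∑[ i < m ] Ds i u w       ≡⟨ ∑-comm (λ u i → Ds i u w) ⟩
  ∑[ i < m ] ∑[ u < n ] Ds i u w       ≡⟨ sum-cong-≗ (λ i → sumF≡∑ (λ u → Ds i u w)) ⟨
  ∑[ i < m ] indeg (Ds i) w            ∎
  where open ≡-Reasoning

outdeg-⋃ : ∀ {n m} (Ds : Fin m → Digraph n) u → outdeg (⋃ Ds) u ≡ ∑[ i < m ] outdeg (Ds i) u
outdeg-⋃ {n} {m} Ds u = begin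
  outdeg (⋃ Ds) u                     ≡⟨ sumF≡∑ (⋃ Ds u) ⟩
  ∑[ w < n ] sumF (λ i → Ds i u w)     ≡⟨ sum-cong-≗ (λ w → sumF≡∑ (λ i → Ds i u w)) ⟩
  ∑[ w < n ] ∑[ i < m ] Ds i u w       ≡⟨ ∑-comm (λ w i → Ds i u w) ⟩
  ∑[ i < m ] ∑[ w < n ] Ds i u w       ≡⟨ sum-cong-≗ (λ i → sumF≡∑ (λ w → Ds i u w)) ⟨
  ∑[ i < m ] outdeg (Ds i) u           ∎
  where open ≡-Reasoning

indeg-S : ∀ {n} (e : Fin n → Bool) u w → indeg (S e u) w ≡ ind (e w ∧ not (eqF w u))
indeg-S e u w = begin
  indeg (S e u) w              ≡⟨ sumF≡∑ (λ x → S e u x w) ⟩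
  sum (λ x → S e u x w)        ≡⟨ ∑-point u (λ x x≢u → cong arc-from (eqF-≢ x≢u)) ⟩
  S e u u w                    ≡⟨ cong arc-from (eqF-refl u) ⟩
  ind (e w ∧ not (eqF w u))    ∎
  where
  open ≡-Reasoning
  arc-from = λ b → ind (b ∧ e w ∧ not (eqF w u))

outdeg-S : ∀ {n} (e : Fin n → Bool) u x →
           outdeg (S e u) x ≡ ind (eqF x u) * count (λ w → e w ∧ not (eqF w u))
outdeg-S {n} e u x = begin
  outdeg (S e u) x                               ≡⟨ sumF≡∑ (S e u x) ⟩
  ∑[ w < n ] ind (eqF x u ∧ target w)            ≡⟨ sum-cong-≗ (λ w → ind-∧ (eqF x u) (target w)) ⟩
  ∑[ w < n ] (ind (eqF x u) * ind (target w))    ≡⟨ *-distribˡ-sum (ind (eqF x u)) (ind ∘ target) ⟨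
  ind (eqF x u) * (∑[ w < n ] ind (target w))    ≡⟨ cong (ind (eqF x u) *_) (count≡∑ target) ⟨
  ind (eqF x u) * count target                   ∎
  where
  open ≡-Reasoning
  target = λ w → e w ∧ not (eqF w u)

coef-cong : ∀ {m} {D D′ : Digraph (suc m)} → (∀ x w → D x w ≡ D′ x w) → coef D ≡ coef D′
coef-cong {m} {D} {D′} D≗D′ = cong₂ ratio τ-cong (cong product (map-cong indeg-cong (allFin (suc m))))
  where
  indeg-cong : ∀ w → indeg D w ≡ indeg D′ w
  indeg-cong w = cong sumList (map-cong (λ u → D≗D′ u w) (allFin (suc m)))
  arbWeight-cong : ∀ p → arbWeight D zero p ≡ arbWeight D′ zero p
  arbWeight-cong p =
    cong product (map-cong (λ x → cong (if eqF x zero then 1 else_) (D≗D′ (p x) x)) (allFin (suc m)))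
  τ-cong : τ D ≡ τ D′
  τ-cong = cong sumList (map-cong (λ p → cong (if isParentTree zero p then_else 0) (arbWeight-cong p))
                                  (allFuns (suc m) (suc m)))

adj-sym : ∀ {n} (D : Digraph n) u w → adj D u w ≡ adj D w u
adj-sym D u w = cong (λ d → not (d ≡ᵇ 0)) (ℕ.+-comm (D u w) (D w u))

arc⇒adj : ∀ {n} (D : Digraph n) u w {d} → D u w ≡ suc d → T (adj D u w)
arc⇒adj D u w arc rewrite arc = _

reach-mono : ∀ {n} (D : Digraph n) u w {t s} → t ≤′ s → T (reach D t u w) → T (reach D s u w)
reach-mono D u w (≤′-reflexive refl) r = r
reach-mono D u w (≤′-step {s} t≤s) r = from (T-∨ {reach D s u w}) (inj₁ (reach-mono D u w t≤s r))

reach-extend : ∀ {n} (D : Digraph n) {t} u x w →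
               T (reach D t u x) → T (adj D x w) → T (reach D (suc t) u w)
reach-extend D {t} u x w r a =
  from (T-∨ {reach D t u w}) (inj₂ (anyB-intro x (from (T-∧ {reach D t u x}) (r , a))))

third-vertex : ∀ {n} (u w : Fin (3 + n)) → ∃ λ x → x ≢ u × x ≢ w
third-vertex u w with u ≟F w
... | yes refl = punchIn u zero , punchInᵢ≢i u zero , punchInᵢ≢i u zero
... | no u≢w =
  punchIn u y , punchInᵢ≢i u y , y≢w′ ∘ Fin.punchIn-injective u y w′ ∘ (λ x≡w → trans x≡w w≡uw′)
  where
  w′ = punchOut u≢w
  y = punchIn w′ zero
  y≢w′ = punchInᵢ≢i w′ zero
  w≡uw′ = sym (punchIn-punchOut u≢w)

module _ {n} (D : Digraph (3 + n)) (partner : Fin (3 + n) → Fin (3 + n))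
         (adjacent : ∀ u w → w ≢ u → w ≢ partner u → T (adj D u w)) where

  private
    reach-0 : ∀ u → T (reach D 0 u u)
    reach-0 u = from T-eqF refl

    reach-1 : ∀ u w → T (adj D u w) → T (reach D 1 u w)
    reach-1 u w = reach-extend D {0} u u w (reach-0 u)

    0≤′2 : 0 ≤′ 2
    0≤′2 = ℕ.≤⇒≤′ z≤n

    1≤′2 : 1 ≤′ 2
    1≤′2 = ℕ.≤⇒≤′ (s≤s z≤n)

    2≤′3+n : 2 ≤′ 3 + n
    2≤′3+n = ℕ.≤⇒≤′ (s≤s (s≤s z≤n))

    reach≤2 : ∀ u w → T (reach D 2 u w)
    reach≤2 u w with w ≟F u | w ≟F partner u | u ≟F partner w
    ... | yes refl | _ | _ = reach-mono D u u 0≤′2 (reach-0 u)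
    ... | no w≢u | no w≢pu | _ = reach-mono D u w 1≤′2 (reach-1 u w (adjacent u w w≢u w≢pu))
    ... | no w≢u | yes _ | no u≢pw =
      reach-mono D u w 1≤′2 (reach-1 u w (subst T (adj-sym D w u) (adjacent w u (w≢u ∘ sym) u≢pw)))
    -- u and w are each other's partners, so a third vertex is a neighbour of both.
    ... | no w≢u | yes w≡pu | yes u≡pw =
      let (x , x≢u , x≢w) = third-vertex u w in
      reach-extend D {1} u x w (reach-1 u x (adjacent u x x≢u (subst (x ≢_) w≡pu x≢w)))
        (subst T (adj-sym D w x) (adjacent w x x≢w (subst (x ≢_) u≡pw x≢u)))

  weaklyConnected-if-≤1-non-neighbour : T (weaklyConnected D)
  weaklyConnected-if-≤1-non-neighbour =
    from (T-allB (λ u → allB (reach D (3 + n) u))) (λ u →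
      from (T-allB (reach D (3 + n) u)) (λ w → reach-mono D u w 2≤′3+n (reach≤2 u w)))

-- Euler rootings of the simplex

isEulerRooting : ∀ {k m} → Hypergraph (suc k) m → (Fin m → Fin m) → (Fin m → Fin (suc k)) → Bool
isEulerRooting H e v = isRooting H e v ∧ Eulerian (D_R H e v)

record IsSimplexRooting {k} (e v : Fin (suc k) → Fin (suc k)) : Set where
  field
    each-edge-once : EachOnce e
    root∈edge      : ∀ i → v i ≢ e i
    roots-sorted   : v Preserves Fin._≤_ ⟶ Fin._≤_

T-isRooting-simplex : ∀ {k} {e v : Fin (suc k) → Fin (suc k)} →
                      T (isRooting (simplex k) e v) ⇔ IsSimplexRooting e v
T-isRooting-simplex {k} {e} {v} = mk⇔ to-record from-record
  where
  hit-once = λ j → count (λ i → eqF (e i) j) ≡ᵇ 1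
  in-edge-at = λ i → simplex k (e i) (v i)
  sorted-at = λ i j → not (leF i j) ∨ leF (v i) (v j)

  to-record : T (isRooting (simplex k) e v) → IsSimplexRooting e v
  to-record h = record
    { each-edge-once = λ j → to T-≡ᵇ (to (T-allB hit-once) once j)
    ; root∈edge      = λ i → to T-not-eqF (to (T-allB in-edge-at) in-edge i)
    ; roots-sorted   = λ {i} {j} i≤j → to T-leF (to (T-not-∨ (leF i j)) (sorted i j) (from T-leF i≤j))
    }
    where
    once-rest = to (T-∧ {allB hit-once}) h
    once = proj₁ once-rest
    in-edge-sorted = to (T-∧ {allB in-edge-at}) (proj₂ once-rest)
    in-edge = proj₁ in-edge-sorted
    sorted : ∀ i j → T (sorted-at i j)
    sorted i j = to (T-allB (sorted-at i)) (to (T-allB (allB ∘ sorted-at)) (proj₂ in-edge-sorted) i) j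

  from-record : IsSimplexRooting e v → T (isRooting (simplex k) e v)
  from-record R = from T-∧
    ( from (T-allB hit-once) (λ j → from T-≡ᵇ (each-edge-once j))
    , from T-∧
      ( from (T-allB in-edge-at) (λ i → from T-not-eqF (root∈edge i))
      , from (T-allB (allB ∘ sorted-at)) (λ i → from (T-allB (sorted-at i)) (λ j →
          from (T-not-∨ (leF i j)) (λ i≤j → from T-leF (roots-sorted (to T-leF i≤j)))))))
    where open IsSimplexRooting R

module _ {k} {e v : Fin (suc k) → Fin (suc k)} (R : IsSimplexRooting e v) where
  open IsSimplexRooting R

  private
    D : Digraph (suc k)
    D = D_R (simplex k) e v

    star : Fin (suc k) → Digraph (suc k)
    star i = S (simplex k (e i)) (v i)

    avoids : Fin (suc k) → Fin (suc k) → Bool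
    avoids i w = not (eqF w (e i)) ∧ not (eqF w (v i))

    edge≢root : ∀ i → e i ≢ v i
    edge≢root i = root∈edge i ∘ sym

  edges-avoiding : ∀ w → count (λ i → not (eqF w (e i))) ≡ k
  edges-avoiding w = ℕ.suc-injective (begin
    suc (count avoiding)                            ≡⟨ cong (_+ count avoiding) containing≡1 ⟨
    count (λ i → eqF w (e i)) + count avoiding      ≡⟨ count+count-not (λ i → eqF w (e i)) ⟩
    suc k                                           ∎)
    where
    open ≡-Reasoning
    avoiding = λ i → not (eqF w (e i))
    containing≡1 = trans (count-cong (λ i → eqF-sym w (e i))) (each-edge-once w)

  indeg+rootCount : ∀ w → indeg D w + rootCount v w ≡ k
  indeg+rootCount w = begin
    indeg D w + rootCount v w
      ≡⟨ cong₂ _+_ (indeg-⋃ star w) (count≡∑ roots-at) ⟩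
    sum (λ i → indeg (star i) w) + sum (ind ∘ roots-at)
      ≡⟨ cong (_+ sum (ind ∘ roots-at)) (sum-cong-≗ (λ i → indeg-S (simplex k (e i)) (v i) w)) ⟩
    sum (λ i → ind (avoids i w)) + sum (ind ∘ roots-at)
      ≡⟨ ∑-distrib-+ (λ i → ind (avoids i w)) (ind ∘ roots-at) ⟨
    ∑[ i < suc k ] (ind (avoids i w) + ind (roots-at i))
      ≡⟨ sum-cong-≗ (λ i → ind-≢-split (edge≢root i) w) ⟨
    sum (λ i → ind (not (eqF w (e i))))
      ≡⟨ count≡∑ (λ i → not (eqF w (e i))) ⟨
    count (λ i → not (eqF w (e i)))
      ≡⟨ edges-avoiding w ⟩
    k ∎
    where
    open ≡-Reasoning
    roots-at = λ i → eqF w (v i)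

  outdeg+rootCount : ∀ u → outdeg D u + rootCount v u ≡ rootCount v u * k
  outdeg+rootCount u = begin
    outdeg D u + rootCount v u
      ≡⟨ cong₂ _+_ (outdeg-⋃ star u) (count≡∑ roots-at) ⟩
    sum (λ i → outdeg (star i) u) + sum (ind ∘ roots-at)
      ≡⟨ cong (_+ sum (ind ∘ roots-at)) (sum-cong-≗ (λ i → outdeg-S (simplex k (e i)) (v i) u)) ⟩
    sum (λ i → ind (roots-at i) * count (avoids i)) + sum (ind ∘ roots-at)
      ≡⟨ ∑-distrib-+ (λ i → ind (roots-at i) * count (avoids i)) (ind ∘ roots-at) ⟨
    ∑[ i < suc k ] (ind (roots-at i) * count (avoids i) + ind (roots-at i))
      ≡⟨ sum-cong-≗ (λ i → x*c+x≡x*k (ind (roots-at i)) (count-avoiding₂ (edge≢root i))) ⟩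
    ∑[ i < suc k ] (ind (roots-at i) * k)
      ≡⟨ *-distribʳ-sum k (ind ∘ roots-at) ⟨
    sum (ind ∘ roots-at) * k
      ≡⟨ cong (_* k) (count≡∑ roots-at) ⟨
    rootCount v u * k ∎
    where
    open ≡-Reasoning
    roots-at = λ i → eqF u (v i)
    x*c+x≡x*k : ∀ x {c} → suc c ≡ k → x * c + x ≡ x * k
    x*c+x≡x*k x {c} refl = trans (ℕ.+-comm (x * c) x) (sym (ℕ.*-suc x c))

  balanced-at⇔rootCount≡1 : .{{NonZero k}} → ∀ w → (indeg D w ≡ outdeg D w) ⇔ (rootCount v w ≡ 1)
  balanced-at⇔rootCount≡1 w = mk⇔
    (λ in≡out → ℕ.*-cancelʳ-≡ (rootCount v w) 1 k (begin
      rootCount v w * k           ≡⟨ outdeg+rootCount w ⟨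
      outdeg D w + rootCount v w  ≡⟨ cong (_+ rootCount v w) in≡out ⟨
      indeg D w + rootCount v w   ≡⟨ indeg+rootCount w ⟩
      k                           ≡⟨ ℕ.*-identityˡ k ⟨
      1 * k                       ∎))
    (λ r≡1 → ℕ.+-cancelʳ-≡ _ (indeg D w) (outdeg D w) (begin
      indeg D w + rootCount v w   ≡⟨ indeg+rootCount w ⟩
      k                           ≡⟨ ℕ.*-identityˡ k ⟨
      1 * k                       ≡⟨ cong (_* k) r≡1 ⟨
      rootCount v w * k           ≡⟨ outdeg+rootCount w ⟨
      outdeg D w + rootCount v w  ∎))
    where open ≡-Reasoning

D_R-simplex-arc : ∀ {k} (e v : Fin (suc k) → Fin (suc k)) → (∀ i → v i ≡ i) →
                  ∀ u w → w ≢ u → w ≢ e u → D_R (simplex k) e v u w ≡ 1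
D_R-simplex-arc {k} e v v≗id u w w≢u w≢eu = begin
  D_R (simplex k) e v u w      ≡⟨ sumF≡∑ (λ i → star i u w) ⟩
  sum (λ i → star i u w)       ≡⟨ ∑-point u (λ i i≢u → cong (arc-from i) (not-root i≢u)) ⟩
  star u u w                   ≡⟨ arc-from-root ⟩
  1                            ∎
  where
  open ≡-Reasoning
  star = λ i → S (simplex k (e i)) (v i)
  arc-from = λ i b → ind (b ∧ simplex k (e i) w ∧ not (eqF w (v i)))
  not-root : ∀ {i} → i ≢ u → eqF u (v i) ≡ false
  not-root {i} i≢u = trans (cong (eqF u) (v≗id i)) (eqF-≢ (i≢u ∘ sym))
  arc-from-root : star u u w ≡ 1
  arc-from-root rewrite v≗id u | eqF-refl u | eqF-≢ w≢eu | eqF-≢ w≢u = refl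

D_R-simplex-identity-roots : ∀ {k} (e v : Fin (suc k) → Fin (suc k)) → (∀ i → v i ≡ i) →
                             ∀ x w → D_R (simplex k) e v x w ≡ Dσ e x w
D_R-simplex-identity-roots {k} e v v≗id x w =
  cong sumList (map-cong (λ i → cong (λ r → S (simplex k (e i)) r x w) (v≗id i)) (allFin (suc k)))

isEulerRooting-simplex⇔ : ∀ {k} → 2 ≤ k → (e v : Fin (suc k) → Fin (suc k)) →
  T (isEulerRooting (simplex k) e v) ⇔ ((∀ i → v i ≡ i) × T (isDerangement e))
isEulerRooting-simplex⇔ {k@(suc (suc _))} (s≤s (s≤s z≤n)) e v = mk⇔ forward backward
  where
  D = D_R (simplex k) e v

  forward : T (isEulerRooting (simplex k) e v) → (∀ i → v i ≡ i) × T (isDerangement e)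
  forward h =
    v≗id , from T-isDerangement (each-edge-once , λ i ei≡i → root∈edge i (trans (v≗id i) (sym ei≡i)))
    where
    rooting-euler = to (T-∧ {isRooting (simplex k) e v}) h
    R = to T-isRooting-simplex (proj₁ rooting-euler)
    open IsSimplexRooting R
    in≡out = proj₂ (to T-Eulerian (proj₂ rooting-euler))
    v≗id : ∀ i → v i ≡ i
    v≗id = sorted-with-unit-rootCounts⇒id v
             (λ w → to (balanced-at⇔rootCount≡1 R w) (in≡out w)) roots-sorted

  backward : (∀ i → v i ≡ i) × T (isDerangement e) → T (isEulerRooting (simplex k) e v)
  backward (v≗id , deranged) =
    from T-∧ (from T-isRooting-simplex R , from T-Eulerian (connected , in≡out))
    where
    once = proj₁ (to (T-isDerangement {σ = e}) deranged)
    moved = proj₂ (to (T-isDerangement {σ = e}) deranged)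
    R : IsSimplexRooting e v
    R = record
      { each-edge-once = once
      ; root∈edge      = λ i vi≡ei → moved i (trans (sym vi≡ei) (v≗id i))
      ; roots-sorted   = λ {i} {j} i≤j → subst₂ Fin._≤_ (sym (v≗id i)) (sym (v≗id j)) i≤j
      }
    in≡out : ∀ w → indeg D w ≡ outdeg D w
    in≡out w = from (balanced-at⇔rootCount≡1 R w)
      (trans (count-cong (λ i → trans (cong (eqF w) (v≗id i)) (eqF-sym w i))) (count-point w))
    connected : T (weaklyConnected D)
    connected = weaklyConnected-if-≤1-non-neighbour D e
      (λ u w w≢u w≢eu → arc⇒adj D u w (D_R-simplex-arc e v v≗id u w w≢u w≢eu))

-- Summing over all rootings

concatMap-allFin-point : ∀ {n} {B : Set} (h : Fin n → List B) a → (∀ x → x ≢ a → h x ≡ []) →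
                         concatMap h (allFin n) ≡ h a
concatMap-allFin-point {B = B} h a h≡[] = trans (cong concat (map-tabulate id h)) (concat-point h a h≡[])
  where
  concat-empty : ∀ {n} (h : Fin n → List B) → (∀ x → h x ≡ []) → concat (tabulate h) ≡ []
  concat-empty {zero} h h≡[] = refl
  concat-empty {suc n} h h≡[] = cong₂ _++_ (h≡[] zero) (concat-empty (h ∘ suc) (h≡[] ∘ suc))
  concat-point : ∀ {n} (h : Fin n → List B) a → (∀ x → x ≢ a → h x ≡ []) →
                 concat (tabulate h) ≡ h a
  concat-point h zero h≡[] =
    trans (cong (h zero ++_) (concat-empty (h ∘ suc) (λ x → h≡[] (suc x) (λ ()))))
          (++-identityʳ (h zero))
  concat-point h (suc a) h≡[] =
    cong₂ _++_ (h≡[] zero (λ ()))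
               (concat-point (h ∘ suc) a (λ x x≢a → h≡[] (suc x) (x≢a ∘ Fin.suc-injective)))

select : ∀ {A B : Set} → (A → Bool) → (A → B) → A → List B
select P F x = if P x then F x ∷ [] else []

select-none : ∀ {A B : Set} (P : A → Bool) (F : A → B) xs →
              (∀ x → ¬ T (P x)) → concatMap (select P F) xs ≡ []
select-none P F [] ¬P = refl
select-none P F (x ∷ xs) ¬P with P x | ¬P x
... | false | _ = select-none P F xs ¬P
... | true | ¬Px = ⊥-elim (¬Px _)

select-unique : ∀ {B : Set} {m n} (g : Fin m → Fin n) (P : (Fin m → Fin n) → Bool) (F : (Fin m → Fin n) → B) →
                ∀ {b} → (∀ f → T (P f) ⇔ (∀ i → f i ≡ g i)) → (∀ f → (∀ i → f i ≡ g i) → F f ≡ b) →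
                concatMap (select P F) (allFuns m n) ≡ b ∷ []
select-unique {m = zero} g P F P⇔ F≡b = single _ (from (P⇔ _) (λ ())) (F≡b _ (λ ()))
  where
  single : ∀ f → T (P f) → F f ≡ _ → concatMap (select P F) (f ∷ []) ≡ _ ∷ []
  single f Pf Ff≡b rewrite to T-≡ Pf = cong (_∷ []) Ff≡b
select-unique {m = suc m} {n} g P F {b} P⇔ F≡b = begin
  concatMap (select P F) (concatMap (λ x → map (cons x) (allFuns m n)) (allFin n))
    ≡⟨ MonadProperties.associative (allFin n) (λ x → map (cons x) (allFuns m n)) (select P F) ⟨
  concatMap (λ x → concatMap (select P F) (map (cons x) (allFuns m n))) (allFin n)
    ≡⟨ concatMap-cong (λ x → concatMap-map (select P F) (cons x) (allFuns m n)) (allFin n) ⟩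
  concatMap (λ x → concatMap (select P F ∘ cons x) (allFuns m n)) (allFin n)
    ≡⟨ concatMap-allFin-point (λ x → concatMap (select P F ∘ cons x) (allFuns m n)) (g zero) other-heads ⟩
  concatMap (select P F ∘ cons (g zero)) (allFuns m n)
    ≡⟨ select-unique (g ∘ suc) (P ∘ cons (g zero)) (F ∘ cons (g zero))
         (λ f → mk⇔ (λ Pf i → to (P⇔ _) Pf (suc i)) (λ f≗g → from (P⇔ _) (cons-≗ f≗g)))
         (λ f f≗g → F≡b _ (cons-≗ f≗g)) ⟩
  b ∷ [] ∎
  where
  open ≡-Reasoning
  cons-≗ : ∀ {f} → (∀ i → f i ≡ g (suc i)) → ∀ i → cons (g zero) f i ≡ g i
  cons-≗ f≗g zero = refl
  cons-≗ f≗g (suc i) = f≗g i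
  other-heads : ∀ x → x ≢ g zero → concatMap (select P F ∘ cons x) (allFuns m n) ≡ []
  other-heads x x≢g0 =
    select-none (P ∘ cons x) (F ∘ cons x) (allFuns m n) (λ f Pf → x≢g0 (to (P⇔ _) Pf zero))

euler-rootings-with-edges : ∀ {k} → 2 ≤ k → (e : Fin (suc k) → Fin (suc k)) →
  concatMap (select (isEulerRooting (simplex k) e) (coef ∘ D_R (simplex k) e)) (allFuns (suc k) (suc k))
  ≡ map (coef ∘ Dσ) (select isDerangement id e)
euler-rootings-with-edges {k} 2≤k e with isDerangement e in deranged
... | true = select-unique id _ _
               (λ v → mk⇔ (proj₁ ∘ to (characterisation v))
                          (λ v≗id → from (characterisation v) (v≗id , from T-≡ deranged)))
               (λ v v≗id → coef-cong (D_R-simplex-identity-roots e v v≗id))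
  where characterisation = isEulerRooting-simplex⇔ 2≤k e
... | false = select-none _ _ (allFuns (suc k) (suc k))
                (λ v euler → subst T deranged (proj₂ (to (isEulerRooting-simplex⇔ 2≤k e v) euler)))

lemma8 : (k : ℕ) → 2 ≤ k →
    C (simplex k) ≡ sumℚ (map (λ σ → coef (Dσ σ)) (derangements (suc k)))
lemma8 k 2≤k = begin
  C (simplex k)
    ≡⟨ cong sumℚ (concatMap-cong (euler-rootings-with-edges 2≤k) functions) ⟩
  sumℚ (concatMap (map (coef ∘ Dσ) ∘ select isDerangement id) functions)
    ≡⟨ cong sumℚ (map-concatMap (coef ∘ Dσ) (select isDerangement id) functions) ⟨
  sumℚ (map (coef ∘ Dσ) (derangements (suc k)))
    ∎
  where
  open ≡-Reasoning
  functions = allFuns (suc k) (suc k)
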